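{- Fix integers $d \geq 3$ and $n \geq 2$, and put $a = d-1$ and $q_k = 1 + a + a^2 + \cdots + a^{k-1}$ for $k \geq 1$. Let $T_n$ be the finite rooted tree in which every non-leaf vertex has exactly $d-1$ children and the path from each leaf to the root has exactly $n-1$ edges, and let $\bar{T}_n$ be the multigraph obtained from $T_n$ by identifying all leaves to a single sink vertex $s$ (keeping all edges, so parallel edges to $s$ arise) and adding one extra edge from the root to $s$. Then the sandpile group of $\bar{T}_n$ (with sink $s$) satisfies \[ SP(\bar{T}_n) \simeq \mathbb{Z}/q_n\mathbb{Z} \;\oplus\; \bigoplus_{k=2}^{n-1} \bigl(\mathbb{Z}/q_k\mathbb{Z}\bigr)^{a^{n-1-k}(a-1)}, \] i.e. $SP(\bar{T}_n) \simeq \mathbb{Z}_{1+a}^{a^{n-3}(a-1)} \oplus \mathbb{Z}_{1+a+a^2}^{a^{n-4}(a-1)} \oplus \cdots \oplus \mathbb{Z}_{1+a+\cdots+a^{n-2}}^{a-1} \oplus \mathbb{Z}_{1+a+\cdots+a^{n-1}}$, where $\mathbb{Z}_m^q$ denotes the direct sum of $q$ copies of $\mathbb{Z}/m\mathbb{Z}$ (for $n=2$ the sum over $k$ is empty).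
   Context: For a finite connected multigraph $G$ (multiple edges allowed, no loops) with vertices $x_1,\dots,x_N$ and a distinguished sink vertex $x_N$, the reduced Laplacian $\Delta$ is the $(N-1)\times(N-1)$ integer matrix with $\Delta_{ii} = -\deg(x_i)$ and $\Delta_{ij} = $ number of edges between $x_i$ and $x_j$ for $i \neq j$. The sandpile group is $SP(G) = \mathbb{Z}^{N-1}/\Delta\mathbb{Z}^{N-1}$. -}

module Defs where

open import Data.Bool using (Bool; true; false; if_then_else_; _∧_; _∨_)
open import Data.Nat using (ℕ; zero; suc; _+_; _*_; _∸_; _^_; _≡ᵇ_; _<ᵇ_; _/_)
open import Data.Integer as ℤ using (ℤ; +_)
open import Data.Integer.Divisibility using () renaming (_∣_ to _∣ℤ_)
open import Data.Fin using (Fin; toℕ) renaming (zero to fzero; suc to fsuc)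
open import Data.List using (List; []; _∷_; map; upTo; length; concat; replicate; lookup)
open import Data.Product using (_×_; _,_; ∃; Σ; proj₁; proj₂)
open import Relation.Binary.PropositionalEquality using (_≡_)
open import Function.Bundles using (_⇔_)

-- A multigraph on vertices 0,1,…,m (i.e. N = m+1 vertices, the sink is the
-- last vertex m) is given by its list of edges; each edge is an unordered
-- pair (u , v) of vertex indices.  Parallel edges = repeated list entries.

Edges : Set
Edges = List (ℕ × ℕ)

countEdges : (ℕ → ℕ → Bool) → Edges → ℕ
countEdges p [] = 0
countEdges p ((u , v) ∷ E) = (if p u v then 1 else 0) + countEdges p E

mult : Edges → ℕ → ℕ → ℕ
mult E i j = countEdges (λ u v → ((u ≡ᵇ i) ∧ (v ≡ᵇ j)) ∨ ((u ≡ᵇ j) ∧ (v ≡ᵇ i))) E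

-- degree of i = number of edges incident to i (graphs have no loops)
deg : Edges → ℕ → ℕ
deg E i = countEdges (λ u v → (u ≡ᵇ i) ∨ (v ≡ᵇ i)) E

redLap : (m : ℕ) → Edges → Fin m → Fin m → ℤ
redLap m E i j =
  if toℕ i ≡ᵇ toℕ j then ℤ.- (+ deg E (toℕ i)) else + mult E (toℕ i) (toℕ j)

sumFin : ∀ {m} → (Fin m → ℤ) → ℤ
sumFin {zero} f = + 0
sumFin {suc m} f = f fzero ℤ.+ sumFin (λ i → f (fsuc i))

ℤ^ : ℕ → Set
ℤ^ k = Fin k → ℤ

_+v_ : ∀ {k} → ℤ^ k → ℤ^ k → ℤ^ k
(x +v y) i = x i ℤ.+ y i

_·_ : ∀ {m} → (Fin m → Fin m → ℤ) → ℤ^ m → ℤ^ m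
(M · z) i = sumFin (λ j → M i j ℤ.* z j)

-- congruence modulo the image of Δ: the sandpile group
-- SP(G) = ℤ^m / Δ ℤ^m is ℤ^m with this equivalence.
_≈SP[_,_]_ : ∀ {m} → ℤ^ m → (m' : ℕ) → Edges → ℤ^ m → Set
_≈SP[_,_]_ {m} x m' E y = Σ (ℤ^ m) (λ z → ∀ i → x i ℤ.- y i ≡ (redLap m E · z) i)

-- The group ⊕_i ℤ/(ms_i)ℤ, represented as ℤ^r with componentwise congruence
_≈C[_]_ : ∀ {r} → ℤ^ r → (ms : Fin r → ℕ) → ℤ^ r → Set
x ≈C[ ms ] y = ∀ i → (+ ms i) ∣ℤ (x i ℤ.- y i)

-- SP(G) ≅ ⊕_{μ ∈ ms} ℤ/μℤ : a map ℤ^m → ℤ^r that is additive modulo the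
-- target congruence, induces a well-defined injective map on classes
-- (x ~ y ⇔ f x ~ f y) and is surjective on classes; i.e. a group
-- isomorphism of the two quotient groups.
SandpileIso : (m : ℕ) → Edges → List ℕ → Set
SandpileIso m E ms =
  Σ (ℤ^ m → ℤ^ (length ms)) λ f →
    (∀ x y → f (x +v y) ≈C[ lookup ms ] (f x +v f y)) ×
    (∀ x y → (_≈SP[_,_]_ x m E y) ⇔ (f x ≈C[ lookup ms ] f y)) ×
    (∀ t → Σ (ℤ^ m) λ x → f x ≈C[ lookup ms ] t)

q : ℕ → ℕ → ℕ
q a zero = 0
q a (suc k) = 1 + a * q a k

-- Vertices of T_n are numbered 0,…,q_n - 1 in breadth-first (heap) order:
-- root 0, the children of vertex i are a*i+1, …, a*i+a.
-- Vertices 0,…,q_{n-1}-1 are the non-leaf vertices, q_{n-1},…,q_n-1 the leaves.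
parent : ℕ → ℕ → ℕ
parent zero c = 0
parent (suc b) c = (c ∸ 1) / suc b

treeEdges : (a n : ℕ) → Edges
treeEdges a n = map (λ c → (parent a c , c)) (map suc (upTo (q a n ∸ 1)))

collapse : (a n : ℕ) → ℕ → ℕ
collapse a n v = if v <ᵇ q a (n ∸ 1) then v else q a (n ∸ 1)

-- edges of T̄_n : images of all tree edges, plus one edge root–sink.
-- Vertex set {0,…,q_{n-1}}, sink = q_{n-1} (the last vertex).
barTEdges : (a n : ℕ) → Edges
barTEdges a n =
  (0 , q a (n ∸ 1)) ∷ map (λ e → (collapse a n (proj₁ e) , collapse a n (proj₂ e))) (treeEdges a n)

moduli : (a n : ℕ) → List ℕ
moduli a n = q a n ∷ concat (map (λ j → replicate (a ^ (n ∸ 1 ∸ (j + 2)) * (a ∸ 1)) (q a (j + 2))) (upTo (n ∸ 2)))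

{-# OPTIONS --safe #-}
-- Number the vertices of T̄_n in heap order: the root is 0 and the children of v are a v + 1, …, a v + a,
-- so the non-sink vertices are 0, …, q_{n-1} - 1, each of degree a + 1. For a vertex v of height s (its
-- descendants at distance s are leaves) let W w s v = Σ_k q_{s-k} · (sum of w over the descendants of v at
-- distance k). Since q_{s+1} = 1 + a q_s, induction from the leaves upwards gives Green's identity
-- W (Δz) s v = q_s z(parent v) - q_{s+1} z(v). Hence Δz is killed by the linear forms W · (n-1) root mod q_n
-- and W · s p_i - W · s p_{a-1} mod q_{s+1}, where p_0, …, p_{a-1} are the children, of height s ≥ 1, of an
-- internal vertex and i < a - 1. Conversely, if w is killed by all these forms, z is solved for from the root
-- downwards by the same identity: at the children of p the residues q_s z(p) - W w s p_i are congruent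
-- modulo q_{s+1} and sum to a multiple of q_{s+1}, which is coprime to a, so each is divisible by q_{s+1}.
-- The forms are jointly onto, witnessed by a vector whose sums over siblings vanish. There are a^t (a - 1)
-- forms of modulus q_{n-1-t} for parents at depth t, which are the claimed moduli after reversing the levels.

module Submission where

open import Defs

open import Data.Bool using (Bool; true; false; if_then_else_; _∧_; _∨_)
open import Data.Bool.Properties using (T-≡)
open import Data.Empty using (⊥-elim)
open import Data.Fin using (Fin; toℕ; fromℕ<) renaming (zero to fzero; suc to fsuc)
import Data.Fin.Properties as Finₚ
open import Data.Fin.Permutation using (_⟨$⟩ʳ_; _⟨$⟩ˡ_; inverseˡ; inverseʳ)
open import Data.Integer as ℤ using (ℤ; +_; _+_; _-_; _*_; -_; 0ℤ; 1ℤ)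
import Data.Integer.Properties as ℤₚ
open import Data.Integer.Divisibility using () renaming (_∣_ to _∣ᵤ_)
open import Data.Integer.Divisibility.Signed
  using (_∣_; divides; _∣?_; ∣-refl; ∣⇒∣ᵤ; ∣ᵤ⇒∣; ∣m∣n⇒∣m+n; ∣m∣n⇒∣m-n; ∣m+n∣m⇒∣n; ∣m⇒∣-m; ∣m⇒∣m*n;
         ∣n⇒∣m*n)
open import Data.Integer.Tactic.RingSolver using (solve-∀)
open import Algebra.Properties.CommutativeSemigroup ℤₚ.+-commutativeSemigroup using () renaming (interchange to +-interchange)
open import Data.List using (List; []; _∷_; [_]; _++_; map; upTo; applyUpTo; length; lookup; concat; replicate)
import Data.List.Properties as Listₚ
open import Data.List.Relation.Unary.All using (All; []; _∷_)
import Data.List.Relation.Unary.All.Properties as Allₚ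
open import Data.Nat as ℕ using (ℕ; zero; suc; _≤_; _<_; z≤n; s≤s; _≡ᵇ_; _<ᵇ_; _/_; _%_; _∸_; _^_)
import Data.Nat.Properties as ℕₚ
import Data.Nat.DivMod as ℕD
import Data.Nat.Divisibility as ℕDiv
open import Data.Product using (Σ; _×_; _,_; proj₁; proj₂)
open import Data.Sum using (inj₁; inj₂)
open import Function.Bundles using (Equivalence; mk⇔)
open import Relation.Binary.PropositionalEquality hiding ([_])
open import Relation.Nullary using (yes; no)
open import Data.List.Relation.Binary.Permutation.Setoid (setoid ℕ) as ↭ using (_↭_)
import Data.List.Relation.Binary.Permutation.Setoid.Properties (setoid ℕ) as ↭ₚ

m-n+n≡m : ∀ m n → m - n + n ≡ m
m-n+n≡m = solve-∀

m+n-n≡m : ∀ m n → m + n - n ≡ m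
m+n-n≡m = solve-∀

m-[m-n]≡n : ∀ m n → m - (m - n) ≡ n
m-[m-n]≡n = solve-∀

m+n-m≡n : ∀ m n → m + n - m ≡ n
m+n-m≡n = solve-∀

minus-interchange : ∀ m n o p → (m - n) + (o - p) ≡ (m + o) - (n + p)
minus-interchange = solve-∀

-- The exact quotient, with junk value 0 when d does not divide x.
_div_ : ℤ → ℤ → ℤ
x div d with d ∣? x
... | yes d∣x = _∣_.quotient d∣x
... | no  _   = 0ℤ

*-div : ∀ {d x} → d ∣ x → d * (x div d) ≡ x
*-div {d} {x} d∣x with d ∣? x
... | yes (divides k x≡k*d) = trans (ℤₚ.*-comm d k) (sym x≡k*d)
... | no  d∤x               = ⊥-elim (d∤x d∣x)

[m*n+r]/n≡m : ∀ m n r .{{_ : ℕ.NonZero n}} → r < n → (m ℕ.* n ℕ.+ r) / n ≡ m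
[m*n+r]/n≡m m n r r<n = begin
  (m ℕ.* n ℕ.+ r) / n     ≡⟨ ℕD.+-distrib-/ (m ℕ.* n) r remainders<n ⟩
  m ℕ.* n / n ℕ.+ r / n   ≡⟨ cong₂ ℕ._+_ (ℕD.m*n/n≡m m n) (ℕD.m<n⇒m/n≡0 r<n) ⟩
  m ℕ.+ 0                 ≡⟨ ℕₚ.+-identityʳ m ⟩
  m                       ∎
  where
  open ≡-Reasoning
  remainders<n : m ℕ.* n % n ℕ.+ r % n < n
  remainders<n = subst₂ (λ x y → x ℕ.+ y < n) (sym (ℕD.m*n%n≡0 m n)) (sym (ℕD.m<n⇒m%n≡m r<n)) r<n

[m*n+r]%n≡r : ∀ m n r .{{_ : ℕ.NonZero n}} → r < n → (m ℕ.* n ℕ.+ r) % n ≡ r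
[m*n+r]%n≡r m n r r<n =
  trans (cong (_% n) (ℕₚ.+-comm (m ℕ.* n) r)) (trans (ℕD.[m+kn]%n≡m%n r m n) (ℕD.m<n⇒m%n≡m r<n))

[m/n]*n+m%n≡m : ∀ m n .{{_ : ℕ.NonZero n}} → m / n ℕ.* n ℕ.+ m % n ≡ m
[m/n]*n+m%n≡m m n = trans (ℕₚ.+-comm (m / n ℕ.* n) (m % n)) (sym (ℕD.m≡m%n+[m/n]*n m n))

≡ᵇ-true⇒≡ : ∀ {m n} → (m ≡ᵇ n) ≡ true → m ≡ n
≡ᵇ-true⇒≡ {m} {n} eq = ℕₚ.≡ᵇ⇒≡ m n (Equivalence.from T-≡ eq)

≢⇒≡ᵇ-false : ∀ {m n} → m ≢ n → (m ≡ᵇ n) ≡ false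
≢⇒≡ᵇ-false {m} {n} m≢n with m ≡ᵇ n in eq
... | true  = ⊥-elim (m≢n (≡ᵇ-true⇒≡ {m} eq))
... | false = refl

<⇒<ᵇ≡true : ∀ {m n} → m < n → (m <ᵇ n) ≡ true
<⇒<ᵇ≡true m<n = Equivalence.to T-≡ (ℕₚ.<⇒<ᵇ m<n)

≥⇒<ᵇ≡false : ∀ {m n} → n ≤ m → (m <ᵇ n) ≡ false
≥⇒<ᵇ≡false {m} {n} n≤m with m <ᵇ n in eq
... | true  = ⊥-elim (ℕₚ.<⇒≱ (ℕₚ.<ᵇ⇒< m n (Equivalence.from T-≡ eq)) n≤m)
... | false = refl

sumUpTo : ℕ → (ℕ → ℤ) → ℤ
sumUpTo zero    f = 0ℤ
sumUpTo (suc n) f = f 0 + sumUpTo n (λ r → f (suc r))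

syntax sumUpTo n (λ r → e) = ∑[ r < n ] e

sumUpTo-cong : ∀ n {f g : ℕ → ℤ} → (∀ r → r < n → f r ≡ g r) → sumUpTo n f ≡ sumUpTo n g
sumUpTo-cong zero    eq = refl
sumUpTo-cong (suc n) eq = cong₂ _+_ (eq 0 (s≤s z≤n)) (sumUpTo-cong n (λ r r<n → eq (suc r) (s≤s r<n)))

sumUpTo-zero : ∀ n → sumUpTo n (λ _ → 0ℤ) ≡ 0ℤ
sumUpTo-zero zero    = refl
sumUpTo-zero (suc n) = trans (ℤₚ.+-identityˡ _) (sumUpTo-zero n)

sumUpTo-distrib-+ : ∀ n (f g : ℕ → ℤ) → ∑[ r < n ] (f r + g r) ≡ sumUpTo n f + sumUpTo n g
sumUpTo-distrib-+ zero    f g = refl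
sumUpTo-distrib-+ (suc n) f g
  rewrite sumUpTo-distrib-+ n (λ r → f (suc r)) (λ r → g (suc r)) = +-interchange (f 0) (g 0) _ _

sumUpTo-distrib-- : ∀ n (f g : ℕ → ℤ) → ∑[ r < n ] (f r - g r) ≡ sumUpTo n f - sumUpTo n g
sumUpTo-distrib-- zero    f g = refl
sumUpTo-distrib-- (suc n) f g
  rewrite sumUpTo-distrib-- n (λ r → f (suc r)) (λ r → g (suc r)) = minus-interchange (f 0) (g 0) _ _

*-distribˡ-sumUpTo : ∀ n k (f : ℕ → ℤ) → k * sumUpTo n f ≡ ∑[ r < n ] (k * f r)
*-distribˡ-sumUpTo zero    k f = ℤₚ.*-zeroʳ k
*-distribˡ-sumUpTo (suc n) k f =
  trans (ℤₚ.*-distribˡ-+ k (f 0) _) (cong (_+_ (k * f 0)) (*-distribˡ-sumUpTo n k (λ r → f (suc r))))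

sumUpTo-const : ∀ n k → ∑[ r < n ] k ≡ + n * k
sumUpTo-const zero    k = sym (ℤₚ.*-zeroˡ k)
sumUpTo-const (suc n) k rewrite sumUpTo-const n k = distrib k (+ n)
  where
  distrib : ∀ k n → k + n * k ≡ (1ℤ + n) * k
  distrib = solve-∀

sumUpTo-shift : ∀ n y (f : ℕ → ℤ) → sumUpTo n f ≡ ∑[ r < n ] (f r - y) + + n * y
sumUpTo-shift n y f = begin
  sumUpTo n f                           ≡⟨ sumUpTo-cong n (λ r _ → sym (m-n+n≡m (f r) y)) ⟩
  ∑[ r < n ] ((f r - y) + y)            ≡⟨ sumUpTo-distrib-+ n (λ r → f r - y) (λ _ → y) ⟩
  ∑[ r < n ] (f r - y) + ∑[ r < n ] y   ≡⟨ cong (_+_ (∑[ r < n ] (f r - y))) (sumUpTo-const n y) ⟩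
  ∑[ r < n ] (f r - y) + + n * y        ∎
  where open ≡-Reasoning

sumUpTo-+ : ∀ m n (f : ℕ → ℤ) → sumUpTo (m ℕ.+ n) f ≡ sumUpTo m f + ∑[ r < n ] f (m ℕ.+ r)
sumUpTo-+ zero    n f = sym (ℤₚ.+-identityˡ _)
sumUpTo-+ (suc m) n f
  rewrite sumUpTo-+ m n (λ r → f (suc r)) = sym (ℤₚ.+-assoc (f 0) _ _)

sumUpTo-* : ∀ m n (f : ℕ → ℤ) → sumUpTo (m ℕ.* n) f ≡ ∑[ p < m ] ∑[ r < n ] f (p ℕ.* n ℕ.+ r)
sumUpTo-* zero    n f = refl
sumUpTo-* (suc m) n f = begin
  sumUpTo (n ℕ.+ m ℕ.* n) f
    ≡⟨ sumUpTo-+ n (m ℕ.* n) f ⟩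
  sumUpTo n f + sumUpTo (m ℕ.* n) (λ r → f (n ℕ.+ r))
    ≡⟨ cong (_+_ (sumUpTo n f)) (sumUpTo-* m n (λ r → f (n ℕ.+ r))) ⟩
  sumUpTo n f + ∑[ p < m ] ∑[ r < n ] f (n ℕ.+ (p ℕ.* n ℕ.+ r))
    ≡⟨ cong (_+_ (sumUpTo n f)) (sumUpTo-cong m (λ p _ → sumUpTo-cong n (λ r _ →
         cong f (sym (ℕₚ.+-assoc n (p ℕ.* n) r))))) ⟩
  ∑[ p < suc m ] ∑[ r < n ] f (p ℕ.* n ℕ.+ r)
    ∎
  where open ≡-Reasoning

⟦_⟧ : Bool → ℤ
⟦ b ⟧ = + (if b then 1 else 0)

sumUpTo-indicator : ∀ n k (f : ℕ → ℤ) → k < n → ∑[ r < n ] (⟦ r ≡ᵇ k ⟧ * f r) ≡ f k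
sumUpTo-indicator (suc n) zero    f _ = trans (cong₂ _+_ (ℤₚ.*-identityˡ (f 0)) (sumUpTo-zero n)) (ℤₚ.+-identityʳ (f 0))
sumUpTo-indicator (suc n) (suc k) f (s≤s k<n) =
  trans (ℤₚ.+-identityˡ _) (sumUpTo-indicator n k (λ r → f (suc r)) k<n)

∣-sumUpTo : ∀ n {d} {f : ℕ → ℤ} → (∀ r → r < n → d ∣ f r) → d ∣ sumUpTo n f
∣-sumUpTo zero    d∣f = divides 0ℤ refl
∣-sumUpTo (suc n) d∣f = ∣m∣n⇒∣m+n (d∣f 0 (s≤s z≤n)) (∣-sumUpTo n (λ r r<n → d∣f (suc r) (s≤s r<n)))

zeroExtend : ∀ {m} → (Fin m → ℤ) → ℕ → ℤ
zeroExtend {zero}  z k       = 0ℤ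
zeroExtend {suc m} z zero    = z fzero
zeroExtend {suc m} z (suc k) = zeroExtend (λ j → z (fsuc j)) k

zeroExtend-toℕ : ∀ {m} (z : Fin m → ℤ) i → zeroExtend z (toℕ i) ≡ z i
zeroExtend-toℕ z fzero    = refl
zeroExtend-toℕ z (fsuc i) = zeroExtend-toℕ (λ j → z (fsuc j)) i

zeroExtend-≥ : ∀ {m} (z : Fin m → ℤ) k → m ≤ k → zeroExtend z k ≡ 0ℤ
zeroExtend-≥ {zero}  z k       _         = refl
zeroExtend-≥ {suc m} z (suc k) (s≤s m≤k) = zeroExtend-≥ (λ j → z (fsuc j)) k m≤k

zeroExtend-< : ∀ {m} (z : Fin m → ℤ) (u : ℕ → ℤ) → (∀ i → z i ≡ u (toℕ i)) →
  ∀ k → k < m → zeroExtend z k ≡ u k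
zeroExtend-< z u z≗u zero    (s≤s _)   = z≗u fzero
zeroExtend-< z u z≗u (suc k) (s≤s k<m) = zeroExtend-< (λ j → z (fsuc j)) (λ k → u (suc k)) (λ j → z≗u (fsuc j)) k k<m

zeroExtend-cong : ∀ {m} {z z′ : Fin m → ℤ} → (∀ i → z i ≡ z′ i) → ∀ k → zeroExtend z k ≡ zeroExtend z′ k
zeroExtend-cong {zero}  eq k       = refl
zeroExtend-cong {suc m} eq zero    = eq fzero
zeroExtend-cong {suc m} eq (suc k) = zeroExtend-cong (λ j → eq (fsuc j)) k

zeroExtend-+ : ∀ {m} (z z′ : Fin m → ℤ) k → zeroExtend (z +v z′) k ≡ zeroExtend z k + zeroExtend z′ k
zeroExtend-+ {zero}  z z′ k       = refl
zeroExtend-+ {suc m} z z′ zero    = refl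
zeroExtend-+ {suc m} z z′ (suc k) = zeroExtend-+ (λ j → z (fsuc j)) (λ j → z′ (fsuc j)) k

sumFin-cong : ∀ {m} {f g : Fin m → ℤ} → (∀ j → f j ≡ g j) → sumFin f ≡ sumFin g
sumFin-cong {zero}  eq = refl
sumFin-cong {suc m} eq = cong₂ _+_ (eq fzero) (sumFin-cong (λ j → eq (fsuc j)))

sumFin-distrib-+ : ∀ {m} (f g : Fin m → ℤ) → sumFin (λ j → f j + g j) ≡ sumFin f + sumFin g
sumFin-distrib-+ {zero}  f g = refl
sumFin-distrib-+ {suc m} f g
  rewrite sumFin-distrib-+ (λ j → f (fsuc j)) (λ j → g (fsuc j)) = +-interchange (f fzero) (g fzero) _ _

sumFin-zero : ∀ m → sumFin {m} (λ _ → 0ℤ) ≡ 0ℤ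
sumFin-zero zero    = refl
sumFin-zero (suc m) = trans (ℤₚ.+-identityˡ _) (sumFin-zero m)

*-distribˡ-sumFin : ∀ {m} k (f : Fin m → ℤ) → sumFin (λ j → k * f j) ≡ k * sumFin f
*-distribˡ-sumFin {zero}  k f = sym (ℤₚ.*-zeroʳ k)
*-distribˡ-sumFin {suc m} k f =
  trans (cong (_+_ (k * f fzero)) (*-distribˡ-sumFin k (λ j → f (fsuc j)))) (sym (ℤₚ.*-distribˡ-+ k _ _))

sumFin-indicator : ∀ {m} k (z : Fin m → ℤ) → sumFin (λ j → ⟦ k ≡ᵇ toℕ j ⟧ * z j) ≡ zeroExtend z k
sumFin-indicator {zero}  k       z = refl
sumFin-indicator {suc m} zero    z =
  trans (cong₂ _+_ (ℤₚ.*-identityˡ (z fzero)) (sumFin-zero m)) (ℤₚ.+-identityʳ (z fzero))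
sumFin-indicator {suc m} (suc k) z = trans (ℤₚ.+-identityˡ _) (sumFin-indicator k (λ j → z (fsuc j)))

sumList : {A : Set} → (A → ℤ) → List A → ℤ
sumList f []       = 0ℤ
sumList f (x ∷ xs) = f x + sumList f xs

sumList-map : {A B : Set} (f : B → ℤ) (g : A → B) (xs : List A) → sumList f (map g xs) ≡ sumList (λ x → f (g x)) xs
sumList-map f g []       = refl
sumList-map f g (x ∷ xs) = cong (_+_ (f (g x))) (sumList-map f g xs)

sumList-applyUpTo : {A : Set} (f : A → ℤ) (g : ℕ → A) (n : ℕ) → sumList f (applyUpTo g n) ≡ ∑[ r < n ] f (g r)
sumList-applyUpTo f g zero    = refl
sumList-applyUpTo f g (suc n) = cong (_+_ (f (g 0))) (sumList-applyUpTo f (λ r → g (suc r)) n)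

applyUpTo-+ : ∀ {A : Set} (f : ℕ → A) m n → applyUpTo f (m ℕ.+ n) ≡ applyUpTo f m ++ applyUpTo (λ j → f (m ℕ.+ j)) n
applyUpTo-+ f zero    n = refl
applyUpTo-+ f (suc m) n = cong (f 0 ∷_) (applyUpTo-+ (λ j → f (suc j)) m n)

applyUpTo-cong : ∀ {A : Set} {f g : ℕ → A} n → (∀ j → j < n → f j ≡ g j) → applyUpTo f n ≡ applyUpTo g n
applyUpTo-cong zero    _   = refl
applyUpTo-cong (suc n) f≡g = cong₂ _∷_ (f≡g 0 (s≤s z≤n)) (applyUpTo-cong n (λ j j<n → f≡g (suc j) (s≤s j<n)))

applyUpTo-replicate : ∀ {A : Set} (f : ℕ → A) {x} n → (∀ j → j < n → f j ≡ x) → applyUpTo f n ≡ replicate n x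
applyUpTo-replicate f zero    _   = refl
applyUpTo-replicate f (suc n) f≡x =
  cong₂ _∷_ (f≡x 0 (s≤s z≤n)) (applyUpTo-replicate (λ j → f (suc j)) n (λ j j<n → f≡x (suc j) (s≤s j<n)))

concat-applyUpTo-suc : ∀ {A : Set} (f : ℕ → List A) n → concat (applyUpTo f (suc n)) ≡ concat (applyUpTo f n) ++ f n
concat-applyUpTo-suc f n = begin
  concat (applyUpTo f (suc n))          ≡⟨ cong concat (sym (Listₚ.applyUpTo-∷ʳ f n)) ⟩
  concat (applyUpTo f n ++ [ f n ])     ≡⟨ sym (Listₚ.concat-++ (applyUpTo f n) [ f n ]) ⟩
  concat (applyUpTo f n) ++ (f n ++ []) ≡⟨ cong (concat (applyUpTo f n) ++_) (Listₚ.++-identityʳ (f n)) ⟩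
  concat (applyUpTo f n) ++ f n         ∎
  where open ≡-Reasoning

concat-applyUpTo-reverse : ∀ (f : ℕ → List ℕ) n → concat (applyUpTo f n) ↭ concat (applyUpTo (λ j → f (n ∸ suc j)) n)
concat-applyUpTo-reverse f zero    = ↭.↭-refl
concat-applyUpTo-reverse f (suc n) = begin
  concat (applyUpTo f (suc n))                              ≡⟨ concat-applyUpTo-suc f n ⟩
  concat (applyUpTo f n) ++ f n                             ↭⟨ ↭ₚ.++-comm (concat (applyUpTo f n)) (f n) ⟩
  f n ++ concat (applyUpTo f n)                             ↭⟨ ↭ₚ.++⁺ˡ (f n) (concat-applyUpTo-reverse f n) ⟩
  f n ++ concat (applyUpTo (λ j → f (n ∸ suc j)) n)         ∎
  where open ↭.PermutationReasoning

-- The reduced Laplacian as a sum over edges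

LoopFree : Edges → Set
LoopFree = All (λ e → proj₁ e ≢ proj₂ e)

-- The contribution of the edge (x , y) to (Δ u)(I).
flow : (ℕ → ℤ) → ℕ → ℕ × ℕ → ℤ
flow u I (x , y) = ⟦ x ≡ᵇ I ⟧ * (u y - u I) + ⟦ y ≡ᵇ I ⟧ * (u x - u I)

edgeEntry : ℕ × ℕ → ℕ → ℕ → ℤ
edgeEntry (x , y) I J =
  if I ≡ᵇ J then - ⟦ (x ≡ᵇ I) ∨ (y ≡ᵇ I) ⟧
            else ⟦ ((x ≡ᵇ I) ∧ (y ≡ᵇ J)) ∨ ((x ≡ᵇ J) ∧ (y ≡ᵇ I)) ⟧

+-countEdges-∷ : ∀ p x y E → + countEdges p ((x , y) ∷ E) ≡ ⟦ p x y ⟧ + + countEdges p E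
+-countEdges-∷ p x y E = ℤₚ.pos-+ (if p x y then 1 else 0) (countEdges p E)

redLap-∷ : ∀ m x y E (i j : Fin m) → redLap m ((x , y) ∷ E) i j ≡ edgeEntry (x , y) (toℕ i) (toℕ j) + redLap m E i j
redLap-∷ m x y E i j with toℕ i ≡ᵇ toℕ j
... | true  = trans (cong -_ (+-countEdges-∷ _ x y E))
                    (ℤₚ.neg-distrib-+ ⟦ (x ≡ᵇ toℕ i) ∨ (y ≡ᵇ toℕ i) ⟧ (+ deg E (toℕ i)))
... | false = +-countEdges-∷ _ x y E

endpoints-distinct : ∀ {x y} K → x ≢ y → ((x ≡ᵇ K) ∧ (y ≡ᵇ K)) ≡ false
endpoints-distinct {x} {y} K x≢y with x ≡ᵇ K in x≡K | y ≡ᵇ K in y≡K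
... | true  | true  = ⊥-elim (x≢y (trans (≡ᵇ-true⇒≡ {x} x≡K) (sym (≡ᵇ-true⇒≡ {y} y≡K))))
... | true  | false = refl
... | false | _     = refl

edgeEntry-split : ∀ {x y} I J → x ≢ y →
  edgeEntry (x , y) I J
  ≡ ⟦ x ≡ᵇ I ⟧ * (⟦ y ≡ᵇ J ⟧ - ⟦ I ≡ᵇ J ⟧) + ⟦ y ≡ᵇ I ⟧ * (⟦ x ≡ᵇ J ⟧ - ⟦ I ≡ᵇ J ⟧)
edgeEntry-split {x} {y} I J x≢y with I ≡ᵇ J in I≡ᵇJ
... | true  with refl ← ≡ᵇ-true⇒≡ {I} {J} I≡ᵇJ = diagonal (x ≡ᵇ I) (y ≡ᵇ I) (endpoints-distinct I x≢y)
  where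
  diagonal : ∀ b c → (b ∧ c) ≡ false → - ⟦ b ∨ c ⟧ ≡ ⟦ b ⟧ * (⟦ c ⟧ - 1ℤ) + ⟦ c ⟧ * (⟦ b ⟧ - 1ℤ)
  diagonal true  false _ = refl
  diagonal false true  _ = refl
  diagonal false false _ = refl
... | false = offDiagonal (x ≡ᵇ I) (y ≡ᵇ I) (x ≡ᵇ J) (y ≡ᵇ J) (endpoints-distinct I x≢y)
  where
  offDiagonal : ∀ b c b′ c′ → (b ∧ c) ≡ false →
    ⟦ (b ∧ c′) ∨ (b′ ∧ c) ⟧ ≡ ⟦ b ⟧ * (⟦ c′ ⟧ - 0ℤ) + ⟦ c ⟧ * (⟦ b′ ⟧ - 0ℤ)
  offDiagonal true  false true  true  _ = refl
  offDiagonal true  false true  false _ = refl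
  offDiagonal true  false false true  _ = refl
  offDiagonal true  false false false _ = refl
  offDiagonal false true  true  _     _ = refl
  offDiagonal false true  false _     _ = refl
  offDiagonal false false true  _     _ = refl
  offDiagonal false false false _     _ = refl

redLap-edge-· : ∀ m {x y} (z : Fin m → ℤ) (i : Fin m) → x ≢ y →
  sumFin (λ j → edgeEntry (x , y) (toℕ i) (toℕ j) * z j) ≡ flow (zeroExtend z) (toℕ i) (x , y)
redLap-edge-· m {x} {y} z i x≢y = begin
  sumFin (λ j → edgeEntry (x , y) I (toℕ j) * z j)
    ≡⟨ sumFin-cong (λ j → trans (cong (_* z j) (edgeEntry-split I (toℕ j) x≢y))
                                (regroup A B ⟦ y ≡ᵇ toℕ j ⟧ ⟦ x ≡ᵇ toℕ j ⟧ ⟦ I ≡ᵇ toℕ j ⟧ (z j))) ⟩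
  sumFin (λ j → A * (⟦ y ≡ᵇ toℕ j ⟧ * z j) + (B * (⟦ x ≡ᵇ toℕ j ⟧ * z j) + C * (⟦ I ≡ᵇ toℕ j ⟧ * z j)))
    ≡⟨ trans (sumFin-distrib-+ (weighted A y) _)
             (cong (_+_ (sumFin (weighted A y))) (sumFin-distrib-+ (weighted B x) (weighted C I))) ⟩
  sumFin (weighted A y) + (sumFin (weighted B x) + sumFin (weighted C I))
    ≡⟨ cong₂ _+_ (indicatorSum A y) (cong₂ _+_ (indicatorSum B x) (indicatorSum C I)) ⟩
  A * u y + (B * u x + C * u I)
    ≡⟨ collect A B (u x) (u y) (u I) ⟩
  flow u I (x , y)
    ∎
  where
  open ≡-Reasoning
  I = toℕ i
  u = zeroExtend z
  A = ⟦ x ≡ᵇ I ⟧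
  B = ⟦ y ≡ᵇ I ⟧
  C = - (A + B)
  weighted : ℤ → ℕ → Fin m → ℤ
  weighted k v j = k * (⟦ v ≡ᵇ toℕ j ⟧ * z j)
  indicatorSum : ∀ k v → sumFin (weighted k v) ≡ k * u v
  indicatorSum k v = trans (*-distribˡ-sumFin k (λ j → ⟦ v ≡ᵇ toℕ j ⟧ * z j)) (cong (k *_) (sumFin-indicator v z))
  regroup : ∀ a b p q r w → (a * (p - r) + b * (q - r)) * w ≡ a * (p * w) + (b * (q * w) + - (a + b) * (r * w))
  regroup = solve-∀
  collect : ∀ a b ux uy uI → a * uy + (b * ux + - (a + b) * uI) ≡ a * (uy - uI) + b * (ux - uI)
  collect = solve-∀

redLap-·-flows : ∀ m E (z : Fin m → ℤ) (i : Fin m) → LoopFree E →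
  (redLap m E · z) i ≡ sumList (flow (zeroExtend z) (toℕ i)) E
redLap-·-flows m []            z i []           = trans (sumFin-cong (λ j → noEntry (toℕ i ≡ᵇ toℕ j) (z j))) (sumFin-zero m)
  where
  noEntry : ∀ b w → (if b then - (+ 0) else + 0) * w ≡ 0ℤ
  noEntry true  w = refl
  noEntry false w = refl
redLap-·-flows m ((x , y) ∷ E) z i (x≢y ∷ lf) = begin
  sumFin (λ j → redLap m ((x , y) ∷ E) i j * z j)
    ≡⟨ sumFin-cong (λ j → trans (cong (_* z j) (redLap-∷ m x y E i j))
                                (ℤₚ.*-distribʳ-+ (z j) (edgeEntry (x , y) (toℕ i) (toℕ j)) (redLap m E i j))) ⟩
  sumFin (λ j → edgeEntry (x , y) (toℕ i) (toℕ j) * z j + redLap m E i j * z j)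
    ≡⟨ sumFin-distrib-+ (λ j → edgeEntry (x , y) (toℕ i) (toℕ j) * z j) (λ j → redLap m E i j * z j) ⟩
  sumFin (λ j → edgeEntry (x , y) (toℕ i) (toℕ j) * z j) + (redLap m E · z) i
    ≡⟨ cong₂ _+_ (redLap-edge-· m z i x≢y) (redLap-·-flows m E z i lf) ⟩
  sumList (flow (zeroExtend z) (toℕ i)) ((x , y) ∷ E)
    ∎
  where open ≡-Reasoning

-- Sandpile isomorphisms from linear maps

record LinearSandpileIso (m : ℕ) (E : Edges) (ms : List ℕ) : Set where
  field
    F            : ℤ^ m → ℤ^ (length ms)
    F-cong       : ∀ {x y} → (∀ j → x j ≡ y j) → ∀ i → F x i ≡ F y i
    F-+          : ∀ x y i → F (x +v y) i ≡ F x i + F y i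
    image⊆kernel : ∀ z i → + lookup ms i ∣ F (redLap m E · z) i
    kernel⊆image : ∀ w → (∀ i → + lookup ms i ∣ F w i) → Σ (ℤ^ m) λ z → ∀ j → w j ≡ (redLap m E · z) j
    onto         : ∀ t → Σ (ℤ^ m) λ x → ∀ i → + lookup ms i ∣ F x i - t i

  private
    _-v_ : ℤ^ m → ℤ^ m → ℤ^ m
    (x -v y) j = x j - y j

    F-- : ∀ x y i → F (x -v y) i ≡ F x i - F y i
    F-- x y i = begin
      F (x -v y) i                      ≡⟨ sym (m+n-n≡m (F (x -v y) i) (F y i)) ⟩
      F (x -v y) i + F y i - F y i      ≡⟨ cong (_- F y i) (sym (F-+ (x -v y) y i)) ⟩
      F ((x -v y) +v y) i - F y i       ≡⟨ cong (_- F y i) (F-cong (λ j → m-n+n≡m (x j) (y j)) i) ⟩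
      F x i - F y i                     ∎
      where open ≡-Reasoning

  sandpileIso : SandpileIso m E ms
  sandpileIso = F , additive , (λ x y → mk⇔ (to x y) (from x y)) , surjective
    where
    additive : ∀ x y → F (x +v y) ≈C[ lookup ms ] (F x +v F y)
    additive x y i = ∣⇒∣ᵤ (subst (+ lookup ms i ∣_)
      (sym (trans (cong (_- (F x i + F y i)) (F-+ x y i)) (ℤₚ.+-inverseʳ (F x i + F y i)))) (divides 0ℤ refl))
    to : ∀ x y → _≈SP[_,_]_ x m E y → F x ≈C[ lookup ms ] F y
    to x y (z , x-y≡Δz) i =
      ∣⇒∣ᵤ (subst (+ lookup ms i ∣_) (trans (sym (F-cong x-y≡Δz i)) (F-- x y i)) (image⊆kernel z i))
    from : ∀ x y → F x ≈C[ lookup ms ] F y → _≈SP[_,_]_ x m E y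
    from x y Fx≈Fy = kernel⊆image (x -v y) (λ i → subst (+ lookup ms i ∣_) (sym (F-- x y i)) (∣ᵤ⇒∣ (Fx≈Fy i)))
    surjective : ∀ t → Σ (ℤ^ m) λ x → F x ≈C[ lookup ms ] t
    surjective t = let x , Fx≈t = onto t in x , λ i → ∣⇒∣ᵤ (Fx≈t i)

SandpileIso-↭ : ∀ {m E ms ms′} → ms ↭ ms′ → SandpileIso m E ms → SandpileIso m E ms′
SandpileIso-↭ {m} {E} {ms} {ms′} ms↭ms′ (f , additive , iff , surjective) =
  f′ , additive′ , (λ x y → mk⇔ (to′ x y) (from′ x y)) , surjective′
  where
  π = ↭.onIndices ms↭ms′
  back : ∀ j → lookup ms (π ⟨$⟩ˡ j) ≡ lookup ms′ j
  back j = trans (↭ₚ.onIndices-lookup ms↭ms′ (π ⟨$⟩ˡ j)) (cong (lookup ms′) (inverseʳ π))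
  f′ : ℤ^ m → ℤ^ (length ms′)
  f′ x j = f x (π ⟨$⟩ˡ j)
  moved : ∀ {u v} → u ≈C[ lookup ms ] v → (λ j → u (π ⟨$⟩ˡ j)) ≈C[ lookup ms′ ] (λ j → v (π ⟨$⟩ˡ j))
  moved {u} {v} u≈v j = subst (λ k → + k ∣ᵤ u (π ⟨$⟩ˡ j) - v (π ⟨$⟩ˡ j)) (back j) (u≈v (π ⟨$⟩ˡ j))
  additive′ : ∀ x y → f′ (x +v y) ≈C[ lookup ms′ ] (f′ x +v f′ y)
  additive′ x y = moved {f (x +v y)} {f x +v f y} (additive x y)
  to′ : ∀ x y → _≈SP[_,_]_ x m E y → f′ x ≈C[ lookup ms′ ] f′ y
  to′ x y x~y = moved {f x} {f y} (Equivalence.to (iff x y) x~y)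
  from′ : ∀ x y → f′ x ≈C[ lookup ms′ ] f′ y → _≈SP[_,_]_ x m E y
  from′ x y fx≈fy = Equivalence.from (iff x y) λ i →
    subst₂ (λ k i′ → + k ∣ᵤ f x i′ - f y i′) (sym (↭ₚ.onIndices-lookup ms↭ms′ i)) (inverseˡ π)
      (fx≈fy (π ⟨$⟩ʳ i))
  surjective′ : ∀ t → Σ (ℤ^ m) λ x → f′ x ≈C[ lookup ms′ ] t
  surjective′ t = let x , fx≈t = surjective (λ i → t (π ⟨$⟩ʳ i)) in
    x , λ j → subst₂ (λ k u → + k ∣ᵤ f x (π ⟨$⟩ˡ j) - u) (back j) (cong t (inverseʳ π)) (fx≈t (π ⟨$⟩ˡ j))

module Heap (c : ℕ) where

  a : ℕ
  a = suc c

  child : ℕ → ℕ → ℕ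
  child v r = suc (v ℕ.* a ℕ.+ r)

  -- The root's parent is the sink, where u vanishes.
  par : (ℕ → ℤ) → ℕ → ℤ
  par u zero    = 0ℤ
  par u (suc v) = u (v / a)

  par-child : ∀ u v {r} → r < a → par u (child v r) ≡ u v
  par-child u v {r} r<a = cong u ([m*n+r]/n≡m v a r r<a)

  child-parent : ∀ v → child (v / a) (v % a) ≡ suc v
  child-parent v = cong suc ([m/n]*n+m%n≡m v a)

  q-mono : ∀ {t t′} → t ≤ t′ → q a t ≤ q a t′
  q-mono {zero}  _           = z≤n
  q-mono {suc t} (s≤s t≤t′) = s≤s (ℕₚ.*-monoʳ-≤ a (q-mono t≤t′))

  q-suc : ∀ t → q a (suc t) ≡ q a t ℕ.+ a ^ t
  q-suc zero    = cong suc (ℕₚ.*-zeroʳ a)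
  q-suc (suc t) = cong suc (trans (cong (a ℕ.*_) (q-suc t)) (ℕₚ.*-distribˡ-+ a (q a t) (a ^ t)))

  record Depth (t v : ℕ) : Set where
    constructor _,_
    field
      lower : q a t ≤ v
      upper : v < q a (suc t)

  Depth-root : Depth 0 0
  Depth-root = z≤n , s≤s z≤n

  Depth-zero : ∀ {v} → Depth 0 v → v ≡ 0
  Depth-zero {zero}  _            = refl
  Depth-zero {suc v} (_ , s≤s v<) with () ← subst (suc v ≤_) (ℕₚ.*-zeroʳ a) v<

  child-≥ : ∀ {k v} r → q a k ≤ v → q a (suc k) ≤ child v r
  child-≥ {k} {v} r qk≤v =
    s≤s (ℕₚ.≤-trans (ℕₚ.*-monoʳ-≤ a qk≤v)
          (ℕₚ.≤-trans (ℕₚ.≤-reflexive (ℕₚ.*-comm a v)) (ℕₚ.m≤m+n (v ℕ.* a) r)))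

  child-< : ∀ {k v r} → v < q a k → r < a → child v r < q a (suc k)
  child-< {k} {v} {r} v<qk r<a = s≤s (begin-strict
    v ℕ.* a ℕ.+ r     <⟨ ℕₚ.+-monoʳ-< (v ℕ.* a) r<a ⟩
    v ℕ.* a ℕ.+ a     ≡⟨ ℕₚ.+-comm (v ℕ.* a) a ⟩
    suc v ℕ.* a       ≤⟨ ℕₚ.*-monoˡ-≤ a v<qk ⟩
    q a k ℕ.* a       ≡⟨ ℕₚ.*-comm (q a k) a ⟩
    a ℕ.* q a k       ∎)
    where open ℕₚ.≤-Reasoning

  Depth-child : ∀ {t v r} → Depth t v → r < a → Depth (suc t) (child v r)
  Depth-child {t} {r = r} (lo , hi) r<a = child-≥ {t} r lo , child-< {suc t} hi r<a

  Depth-parent : ∀ {t v} → Depth (suc t) (suc v) → Depth t (v / a)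
  Depth-parent {t} {v} (s≤s lo , s≤s hi) =
    ℕₚ.≤-trans (ℕₚ.≤-reflexive (sym (ℕD.m*n/n≡m (q a t) a)))
               (ℕD./-monoˡ-≤ a (ℕₚ.≤-trans (ℕₚ.≤-reflexive (ℕₚ.*-comm (q a t) a)) lo)) ,
    ℕD.m<n*o⇒m/o<n (subst (v <_) (ℕₚ.*-comm a (q a (suc t))) hi)

  <-Depth : ∀ {t v k} → Depth t v → v < q a k → t < k
  <-Depth (lo , _) v<qk = ℕₚ.≰⇒> (λ k≤t → ℕₚ.<⇒≱ v<qk (ℕₚ.≤-trans (q-mono k≤t) lo))

  Depth-< : ∀ {t v k} → Depth t v → t < k → v < q a k
  Depth-< (_ , hi) t<k = ℕₚ.<-≤-trans hi (q-mono t<k)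

  Depth-≥ : ∀ {t v k} → Depth t v → k ≤ t → q a k ≤ v
  Depth-≥ (lo , _) k≤t = ℕₚ.≤-trans (q-mono k≤t) lo

  Depth-unique : ∀ {t t′ v} → Depth t v → Depth t′ v → t ≡ t′
  Depth-unique d d′ =
    ℕₚ.≤-antisym (ℕₚ.≤-pred (<-Depth d (Depth.upper d′))) (ℕₚ.≤-pred (<-Depth d′ (Depth.upper d)))

  -- The fuel f bounds the number of steps up to the root; the fuel v is always enough.
  depthWithin : ℕ → ℕ → ℕ
  depthWithin _       zero    = 0
  depthWithin zero    (suc v) = 0
  depthWithin (suc f) (suc v) = suc (depthWithin f (v / a))

  depth : ℕ → ℕ
  depth v = depthWithin v v

  Depth-depthWithin : ∀ f v → v ≤ f → Depth (depthWithin f v) v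
  Depth-depthWithin _       zero    _         = Depth-root
  Depth-depthWithin (suc f) (suc v) (s≤s v≤f) =
    subst (Depth _) (child-parent v)
      (Depth-child (Depth-depthWithin f (v / a) (ℕₚ.≤-trans (ℕD.m/n≤m v a) v≤f)) (ℕD.m%n<n v a))

  Depth-depth : ∀ v → Depth (depth v) v
  Depth-depth v = Depth-depthWithin v v ℕₚ.≤-refl

  depth-≡ : ∀ {t v} → Depth t v → depth v ≡ t
  depth-≡ = Depth-unique (Depth-depth _)

  -- Green's identity

  Lap : (ℕ → ℤ) → ℕ → ℤ
  Lap u v = ∑[ r < a ] u (child v r) + par u v - + suc a * u v

  Q : ℕ → ℤ
  Q s = + q a s

  Q-suc : ∀ s → Q (suc s) ≡ 1ℤ + + a * Q s
  Q-suc s = cong (_+_ 1ℤ) (ℤₚ.pos-* a (q a s))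

  Q-suc-suc : ∀ s → Q (suc (suc s)) ≡ 1ℤ + + a * (1ℤ + + a * Q s)
  Q-suc-suc s = trans (Q-suc (suc s)) (cong (λ x → 1ℤ + + a * x) (Q-suc s))

  W : (ℕ → ℤ) → ℕ → ℕ → ℤ
  W u zero    v = 0ℤ
  W u (suc s) v = Q (suc s) * u v + ∑[ r < a ] W u s (child v r)

  W-cong : ∀ {u u′} → (∀ v → u v ≡ u′ v) → ∀ s v → W u s v ≡ W u′ s v
  W-cong eq zero    v = refl
  W-cong eq (suc s) v = cong₂ _+_ (cong (_*_ (Q (suc s))) (eq v)) (sumUpTo-cong a (λ r _ → W-cong eq s (child v r)))

  W-+ : ∀ u u′ s v → W (λ k → u k + u′ k) s v ≡ W u s v + W u′ s v
  W-+ u u′ zero    v = refl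
  W-+ u u′ (suc s) v = begin
    Q (suc s) * (u v + u′ v) + ∑[ r < a ] W (λ k → u k + u′ k) s (child v r)
      ≡⟨ cong₂ _+_ (ℤₚ.*-distribˡ-+ (Q (suc s)) (u v) (u′ v))
                   (trans (sumUpTo-cong a (λ r _ → W-+ u u′ s (child v r)))
                          (sumUpTo-distrib-+ a (λ r → W u s (child v r)) (λ r → W u′ s (child v r)))) ⟩
    (Q (suc s) * u v + Q (suc s) * u′ v) + (∑[ r < a ] W u s (child v r) + ∑[ r < a ] W u′ s (child v r))
      ≡⟨ +-interchange (Q (suc s) * u v) (Q (suc s) * u′ v) (∑[ r < a ] W u s (child v r)) (∑[ r < a ] W u′ s (child v r)) ⟩
    W u (suc s) v + W u′ (suc s) v
      ∎
    where open ≡-Reasoning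

  gap : (ℕ → ℤ) → ℕ → ℕ → ℕ → ℤ
  gap u s v i = W u s (child v i) - W u s (child v c)

  Green : (ℕ → ℤ) → (ℕ → ℤ) → ℕ → ℕ → Set
  Green w z s v = W w s v ≡ Q s * par z v - Q (suc s) * z v

  W-suc-residues : ∀ (w z : ℕ → ℤ) s v →
    W w (suc s) v ≡ Q (suc s) * w v + (+ a * (Q s * z v) - ∑[ r < a ] (Q s * z v - W w s (child v r)))
  W-suc-residues w z s v = cong (_+_ (Q (suc s) * w v)) (begin
    ΣW
      ≡⟨ sym (m-[m-n]≡n K ΣW) ⟩
    K - (K - ΣW)
      ≡⟨ cong (λ x → K - (x - ΣW)) (sym (sumUpTo-const a (Q s * z v))) ⟩
    K - (∑[ r < a ] (Q s * z v) - ΣW)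
      ≡⟨ cong (_-_ K) (sym (sumUpTo-distrib-- a (λ _ → Q s * z v) (λ r → W w s (child v r)))) ⟩
    K - ∑[ r < a ] (Q s * z v - W w s (child v r))
      ∎)
    where
    open ≡-Reasoning
    K = + a * (Q s * z v)
    ΣW = ∑[ r < a ] W w s (child v r)

  green-suc : ∀ {w z s v} → (∀ r → r < a → Green w z s (child v r)) →
    W w (suc s) v ≡ (Q (suc s) * par z v - Q (suc (suc s)) * z v) + Q (suc s) * (w v - Lap z v)
  green-suc {w} {z} {s} {v} greenChildren = begin
    W w (suc s) v
      ≡⟨ W-suc-residues w z s v ⟩
    Q (suc s) * w v + (+ a * (Q s * z v) - ∑[ r < a ] (Q s * z v - W w s (child v r)))
      ≡⟨ cong (λ x → Q (suc s) * w v + (+ a * (Q s * z v) - x)) (sumUpTo-cong a residue) ⟩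
    Q (suc s) * w v + (+ a * (Q s * z v) - ∑[ r < a ] (Q (suc s) * z (child v r)))
      ≡⟨ cong (λ x → Q (suc s) * w v + (+ a * (Q s * z v) - x))
              (sym (*-distribˡ-sumUpTo a (Q (suc s)) (λ r → z (child v r)))) ⟩
    Q (suc s) * w v + (+ a * (Q s * z v) - Q (suc s) * ∑[ r < a ] z (child v r))
      ≡⟨ cong (λ x → x * w v + (+ a * (Q s * z v) - x * ∑[ r < a ] z (child v r))) (Q-suc s) ⟩
    (1ℤ + + a * Q s) * w v + (+ a * (Q s * z v) - (1ℤ + + a * Q s) * ∑[ r < a ] z (child v r))
      ≡⟨ telescope (+ a) (Q s) (w v) (z v) (par z v) (∑[ r < a ] z (child v r)) ⟩
    ((1ℤ + + a * Q s) * par z v - (1ℤ + + a * (1ℤ + + a * Q s)) * z v) + (1ℤ + + a * Q s) * (w v - Lap z v)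
      ≡⟨ sym (cong₂ (λ x y → (x * par z v - y * z v) + x * (w v - Lap z v)) (Q-suc s) (Q-suc-suc s)) ⟩
    (Q (suc s) * par z v - Q (suc (suc s)) * z v) + Q (suc s) * (w v - Lap z v)
      ∎
    where
    open ≡-Reasoning
    residue : ∀ r → r < a → Q s * z v - W w s (child v r) ≡ Q (suc s) * z (child v r)
    residue r r<a rewrite greenChildren r r<a | par-child z v r<a = m-[m-n]≡n (Q s * z v) (Q (suc s) * z (child v r))
    telescope : ∀ A q₀ wv zv pv Σz →
      (1ℤ + A * q₀) * wv + (A * (q₀ * zv) - (1ℤ + A * q₀) * Σz)
      ≡ ((1ℤ + A * q₀) * pv - (1ℤ + A * (1ℤ + A * q₀)) * zv) + (1ℤ + A * q₀) * (wv - (Σz + pv - (1ℤ + A) * zv))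
    telescope = solve-∀

  residues-sum : ∀ {w z s v} → Green w z (suc s) v →
    ∑[ r < a ] (Q s * z v - W w s (child v r)) ≡ Q (suc s) * (+ suc a * z v - par z v + w v)
  residues-sum {w} {z} {s} {v} green = begin
    R
      ≡⟨ isolate (Q (suc s) * w v) K R ⟩
    Q (suc s) * w v + K - (Q (suc s) * w v + (K - R))
      ≡⟨ cong (_-_ (Q (suc s) * w v + K)) (sym (W-suc-residues w z s v)) ⟩
    Q (suc s) * w v + K - W w (suc s) v
      ≡⟨ cong (_-_ (Q (suc s) * w v + K)) green ⟩
    Q (suc s) * w v + K - (Q (suc s) * par z v - Q (suc (suc s)) * z v)
      ≡⟨ cong₂ (λ x y → x * w v + K - (x * par z v - y * z v)) (Q-suc s) (Q-suc-suc s) ⟩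
    (1ℤ + + a * Q s) * w v + K - ((1ℤ + + a * Q s) * par z v - (1ℤ + + a * (1ℤ + + a * Q s)) * z v)
      ≡⟨ collect (+ a) (Q s) (w v) (z v) (par z v) ⟩
    (1ℤ + + a * Q s) * (+ suc a * z v - par z v + w v)
      ≡⟨ cong (_* (+ suc a * z v - par z v + w v)) (sym (Q-suc s)) ⟩
    Q (suc s) * (+ suc a * z v - par z v + w v)
      ∎
    where
    open ≡-Reasoning
    K = + a * (Q s * z v)
    R = ∑[ r < a ] (Q s * z v - W w s (child v r))
    isolate : ∀ x k r → r ≡ x + k - (x + (k - r))
    isolate = solve-∀
    collect : ∀ A q₀ wv zv pv →
      (1ℤ + A * q₀) * wv + A * (q₀ * zv) - ((1ℤ + A * q₀) * pv - (1ℤ + A * (1ℤ + A * q₀)) * zv)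
      ≡ (1ℤ + A * q₀) * ((1ℤ + A) * zv - pv + wv)
    collect = solve-∀

  green⇒Lap : ∀ {w z s v} → (∀ r → r < a → Green w z s (child v r)) → Green w z (suc s) v → w v ≡ Lap z v
  green⇒Lap {w} {z} {s} {v} greenChildren green =
    ℤₚ.i-j≡0⇒i≡j (w v) (Lap z v) (ℤₚ.*-cancelˡ-≡ (Q (suc s)) (w v - Lap z v) 0ℤ (begin
      Q (suc s) * (w v - Lap z v)        ≡⟨ sym (m+n-m≡n G _) ⟩
      G + Q (suc s) * (w v - Lap z v) - G ≡⟨ cong (_- G) (sym (green-suc {w} {z} {s} {v} greenChildren)) ⟩
      W w (suc s) v - G                  ≡⟨ cong (_- G) green ⟩
      G - G                              ≡⟨ ℤₚ.+-inverseʳ G ⟩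
      0ℤ                                 ≡⟨ sym (ℤₚ.*-zeroʳ (Q (suc s))) ⟩
      Q (suc s) * 0ℤ                     ∎))
    where
    open ≡-Reasoning
    G = Q (suc s) * par z v - Q (suc (suc s)) * z v

  -- Q (suc s) = 1 + a * Q s is coprime to a, so it divides the last residue once it divides a times it.
  residues-divisible : ∀ {w z s v} → Green w z (suc s) v →
    (∀ i → i < c → Q (suc s) ∣ gap w s v i) →
    ∀ r → r < a → Q (suc s) ∣ Q s * z v - W w s (child v r)
  residues-divisible {w} {z} {s} {v} green siblings r r<a =
    subst (d ∣_) (m-n+n≡m (X r) (X c)) (∣m∣n⇒∣m+n (differences r r<a) last)
    where
    d = Q (suc s)
    X : ℕ → ℤ
    X r = Q s * z v - W w s (child v r)
    differences : ∀ r → r < a → d ∣ X r - X c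
    differences r (s≤s r≤c) with ℕₚ.m≤n⇒m<n∨m≡n r≤c
    ... | inj₁ r<c  = subst (d ∣_) (flip (Q s * z v) (W w s (child v r)) (W w s (child v c))) (∣m⇒∣-m (siblings r r<c))
      where
      flip : ∀ k x y → - (x - y) ≡ (k - x) - (k - y)
      flip = solve-∀
    ... | inj₂ refl = subst (d ∣_) (sym (ℤₚ.+-inverseʳ (X c))) (divides 0ℤ refl)
    a*last : d ∣ + a * X c
    a*last = ∣m+n∣m⇒∣n (subst (d ∣_) (sumUpTo-shift a (X c) X)
                         (subst (d ∣_) (sym (residues-sum {w} {z} {s} {v} green))
                                (∣m⇒∣m*n (+ suc a * z v - par z v + w v) ∣-refl)))
                       (∣-sumUpTo a differences)
    last : d ∣ X c
    last = subst (d ∣_) (trans (cong (λ e → e * X c - Q s * (+ a * X c)) (Q-suc s)) (bezout (+ a) (Q s) (X c)))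
                 (∣m∣n⇒∣m-n (∣m⇒∣m*n (X c) ∣-refl) (∣n⇒∣m*n (Q s) a*last))
      where
      bezout : ∀ A q₀ x → (1ℤ + A * q₀) * x - q₀ * (A * x) ≡ x
      bezout = solve-∀

  gap-green : ∀ {w z s v i} → Green w z s (child v i) → Green w z s (child v c) → i < a →
    gap w s v i ≡ Q (suc s) * (z (child v c) - z (child v i))
  gap-green {w} {z} {s} {v} {i} green-i green-c i<a
    rewrite green-i | green-c | par-child z v i<a | par-child z v (ℕₚ.n<1+n c) =
    difference (Q s * z v) (Q (suc s)) (z (child v i)) (z (child v c))
    where
    difference : ∀ k d x y → (k - d * x) - (k - d * y) ≡ d * (y - x)
    difference = solve-∀

  exact⇒green : ∀ {w z s v} → Q (suc s) * z v ≡ Q s * par z v - W w s v → Green w z s v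
  exact⇒green {w} {z} {s} {v} exact = begin
    W w s v                                       ≡⟨ sym (m-[m-n]≡n (Q s * par z v) (W w s v)) ⟩
    Q s * par z v - (Q s * par z v - W w s v)     ≡⟨ cong (_-_ (Q s * par z v)) (sym exact) ⟩
    Q s * par z v - Q (suc s) * z v               ∎
    where open ≡-Reasoning

module CollapsedTree (c n′ : ℕ) where

  open Heap c public

  N : ℕ
  N = suc n′

  S : ℕ
  S = q a N

  E : Edges
  E = barTEdges a (suc N)

  VanishesFrom : ℕ → (ℕ → ℤ) → Set
  VanishesFrom m u = ∀ k → m ≤ k → u k ≡ 0ℤ

  col : ℕ → ℕ
  col = collapse a (suc N)

  col-< : ∀ {v} → v < S → col v ≡ v
  col-< v<S rewrite <⇒<ᵇ≡true v<S = refl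

  col-≥ : ∀ {v} → S ≤ v → col v ≡ S
  col-≥ S≤v rewrite ≥⇒<ᵇ≡false S≤v = refl

  sumList-E : ∀ (f : ℕ × ℕ → ℤ) → sumList f E ≡ f (0 , S) + ∑[ k < a ℕ.* S ] f (col (k / a) , col (suc k))
  sumList-E f = cong (_+_ (f (0 , S))) (begin
    sumList f (map collapsePair (map treeEdge (map suc (upTo K))))
      ≡⟨ sumList-map f collapsePair (map treeEdge (map suc (upTo K))) ⟩
    sumList (λ e → f (collapsePair e)) (map treeEdge (map suc (upTo K)))
      ≡⟨ sumList-map (λ e → f (collapsePair e)) treeEdge (map suc (upTo K)) ⟩
    sumList (λ v → f (collapsePair (treeEdge v))) (map suc (upTo K))
      ≡⟨ sumList-map (λ v → f (collapsePair (treeEdge v))) suc (upTo K) ⟩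
    sumList (λ k → f (collapsePair (treeEdge (suc k)))) (upTo K)
      ≡⟨ sumList-applyUpTo (λ k → f (collapsePair (treeEdge (suc k)))) (λ k → k) K ⟩
    ∑[ k < K ] f (col (k / a) , col (suc k))
      ∎)
    where
    open ≡-Reasoning
    K = a ℕ.* S
    treeEdge : ℕ → ℕ × ℕ
    treeEdge v = parent a v , v
    collapsePair : ℕ × ℕ → ℕ × ℕ
    collapsePair e = col (proj₁ e) , col (proj₂ e)

  k/a<S : ∀ {k} → k < a ℕ.* S → k / a < S
  k/a<S {k} k<aS = ℕD.m<n*o⇒m/o<n (subst (k <_) (ℕₚ.*-comm a S) k<aS)

  loopFree : LoopFree E
  loopFree = (λ ()) ∷ Allₚ.map⁺ (Allₚ.map⁺ (Allₚ.map⁺ (Allₚ.applyUpTo⁺₁ (λ k → k) (a ℕ.* S) distinct)))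
    where
    distinct : ∀ {k} → k < a ℕ.* S → col (k / a) ≢ col (suc k)
    distinct {k} k<aS rewrite col-< (k/a<S k<aS) with suc k ℕ.<? S
    ... | yes k+1<S rewrite col-< k+1<S = λ eq → ℕₚ.<-irrefl eq (s≤s (ℕD.m/n≤m k a))
    ... | no  k+1≮S rewrite col-≥ (ℕₚ.≮⇒≥ k+1≮S) = λ eq → ℕₚ.<-irrefl eq (k/a<S k<aS)

  flow-treeEdge : ∀ {u I k} → VanishesFrom S u → I < S → k < a ℕ.* S →
    flow u I (col (k / a) , col (suc k)) ≡ ⟦ k / a ≡ᵇ I ⟧ * (u (suc k) - u I) + ⟦ suc k ≡ᵇ I ⟧ * (u (k / a) - u I)
  flow-treeEdge {u} {I} {k} u≥S≡0 I<S k<aS rewrite col-< (k/a<S k<aS) with suc k ℕ.<? S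
  ... | yes k+1<S rewrite col-< k+1<S = refl
  ... | no  k+1≮S
    rewrite col-≥ (ℕₚ.≮⇒≥ k+1≮S) | u≥S≡0 S ℕₚ.≤-refl | u≥S≡0 (suc k) (ℕₚ.≮⇒≥ k+1≮S)
          | ≢⇒≡ᵇ-false (ℕₚ.>⇒≢ I<S)
          | ≢⇒≡ᵇ-false (ℕₚ.>⇒≢ (ℕₚ.<-≤-trans I<S (ℕₚ.≮⇒≥ k+1≮S))) = refl

  ∑-flowToChildren : ∀ (u : ℕ → ℤ) {I} → I < S →
    ∑[ k < a ℕ.* S ] (⟦ k / a ≡ᵇ I ⟧ * (u (suc k) - u I)) ≡ ∑[ r < a ] u (child I r) - + a * u I
  ∑-flowToChildren u {I} I<S = begin
    sumUpTo (a ℕ.* S) toChild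
      ≡⟨ cong (λ n → sumUpTo n toChild) (ℕₚ.*-comm a S) ⟩
    sumUpTo (S ℕ.* a) toChild
      ≡⟨ sumUpTo-* S a toChild ⟩
    ∑[ p < S ] ∑[ r < a ] toChild (p ℕ.* a ℕ.+ r)
      ≡⟨ sumUpTo-cong S (λ p _ → trans (sumUpTo-cong a (λ r r<a →
           cong (λ x → ⟦ x ≡ᵇ I ⟧ * (u (child p r) - u I)) ([m*n+r]/n≡m p a r r<a)))
           (sym (*-distribˡ-sumUpTo a ⟦ p ≡ᵇ I ⟧ (λ r → u (child p r) - u I)))) ⟩
    ∑[ p < S ] (⟦ p ≡ᵇ I ⟧ * ∑[ r < a ] (u (child p r) - u I))
      ≡⟨ sumUpTo-indicator S I (λ p → ∑[ r < a ] (u (child p r) - u I)) I<S ⟩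
    ∑[ r < a ] (u (child I r) - u I)
      ≡⟨ sumUpTo-distrib-- a (λ r → u (child I r)) (λ _ → u I) ⟩
    ∑[ r < a ] u (child I r) - ∑[ r < a ] u I
      ≡⟨ cong (_-_ (∑[ r < a ] u (child I r))) (sumUpTo-const a (u I)) ⟩
    ∑[ r < a ] u (child I r) - + a * u I
      ∎
    where
    open ≡-Reasoning
    toChild : ℕ → ℤ
    toChild k = ⟦ k / a ≡ᵇ I ⟧ * (u (suc k) - u I)

  -- The root reaches its parent, the sink, through the extra edge; every other vertex through a tree edge.
  flowToParent : ∀ {u} I → VanishesFrom S u → I < S →
    flow u I (0 , S) + ∑[ k < a ℕ.* S ] (⟦ suc k ≡ᵇ I ⟧ * (u (k / a) - u I)) ≡ par u I - u I
  flowToParent {u} zero u≥S≡0 _ rewrite u≥S≡0 S ℕₚ.≤-refl | sumUpTo-zero (a ℕ.* S) = root (u 0)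
    where
    root : ∀ u₀ → 1ℤ * (0ℤ - u₀) + 0ℤ * (u₀ - u₀) + 0ℤ ≡ 0ℤ - u₀
    root = solve-∀
  flowToParent {u} (suc I) _ I+1<S
    rewrite ≢⇒≡ᵇ-false (ℕₚ.>⇒≢ I+1<S)
          | sumUpTo-indicator (a ℕ.* S) I (λ k → u (k / a) - u (suc I))
                              (ℕₚ.<-≤-trans (ℕₚ.<-trans (ℕₚ.n<1+n I) I+1<S) (ℕₚ.m≤n*m S a))
    = nonRoot (u (suc I)) (u 0) (u S) (u (I / a))
    where
    nonRoot : ∀ uI u₀ uS uP → 0ℤ * (uS - uI) + 0ℤ * (u₀ - uI) + (uP - uI) ≡ uP - uI
    nonRoot = solve-∀

  sumList-flow-E : ∀ u I → VanishesFrom S u → I < S → sumList (flow u I) E ≡ Lap u I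
  sumList-flow-E u I u≥S≡0 I<S = begin
    sumList (flow u I) E
      ≡⟨ sumList-E (flow u I) ⟩
    flow u I (0 , S) + ∑[ k < K ] flow u I (col (k / a) , col (suc k))
      ≡⟨ cong (_+_ (flow u I (0 , S))) (trans (sumUpTo-cong K (λ k → flow-treeEdge u≥S≡0 I<S))
                                              (sumUpTo-distrib-+ K toChild toParent)) ⟩
    flow u I (0 , S) + (sumUpTo K toChild + sumUpTo K toParent)
      ≡⟨ regroup (flow u I (0 , S)) (sumUpTo K toChild) (sumUpTo K toParent) ⟩
    sumUpTo K toChild + (flow u I (0 , S) + sumUpTo K toParent)
      ≡⟨ cong₂ _+_ (∑-flowToChildren u I<S) (flowToParent I u≥S≡0 I<S) ⟩
    (∑[ r < a ] u (child I r) - + a * u I) + (par u I - u I)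
      ≡⟨ collect (∑[ r < a ] u (child I r)) (+ a) (u I) (par u I) ⟩
    Lap u I
      ∎
    where
    open ≡-Reasoning
    K = a ℕ.* S
    toChild toParent : ℕ → ℤ
    toChild  k = ⟦ k / a ≡ᵇ I ⟧ * (u (suc k) - u I)
    toParent k = ⟦ suc k ≡ᵇ I ⟧ * (u (k / a) - u I)
    regroup : ∀ x y z → x + (y + z) ≡ y + (x + z)
    regroup = solve-∀
    collect : ∀ X A uI uP → (X - A * uI) + (uP - uI) ≡ X + uP - (1ℤ + A) * uI
    collect = solve-∀

  redLap-E-· : ∀ (z : Fin S → ℤ) i → (redLap S E · z) i ≡ Lap (zeroExtend z) (toℕ i)
  redLap-E-· z i = trans (redLap-·-flows S E z i loopFree)
                         (sumList-flow-E (zeroExtend z) (toℕ i) (zeroExtend-≥ z) (Finₚ.toℕ<n i))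

  leaf-height : ∀ {t} → t ℕ.+ 0 ≡ N → N ≤ t
  leaf-height {t} t+0≡N = ℕₚ.≤-reflexive (trans (sym t+0≡N) (ℕₚ.+-identityʳ t))

  <-height : ∀ {t s} → t ℕ.+ suc s ≡ N → t < N
  <-height {t} t+s+1≡N = subst (t <_) t+s+1≡N (ℕₚ.m<m+n t (s≤s z≤n))

  ∸-height : ∀ {t s} → t ℕ.+ s ≡ N → N ∸ t ≡ s
  ∸-height {t} {s} t+s≡N = trans (cong (_∸ t) (sym t+s≡N)) (ℕₚ.m+n∸m≡n t s)

  child-height : ∀ {t s} → t ℕ.+ suc s ≡ N → suc t ℕ.+ s ≡ N
  child-height {t} {s} t+s+1≡N = trans (sym (ℕₚ.+-suc t s)) t+s+1≡N

  green-leaf : ∀ (w : ℕ → ℤ) {z t v} → VanishesFrom S z → Depth t v → t ℕ.+ 0 ≡ N → Green w z 0 v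
  green-leaf w {z} {v = v} z≥S≡0 d t+0≡N rewrite z≥S≡0 v (Depth-≥ d (leaf-height t+0≡N)) = vanish (par z v) (Q 1)
    where
    vanish : ∀ p y → 0ℤ ≡ 0ℤ * p - y * 0ℤ
    vanish = solve-∀

  green-Lap : ∀ {w z} → VanishesFrom S z → (∀ v → v < S → w v ≡ Lap z v) →
    ∀ s {t v} → Depth t v → t ℕ.+ s ≡ N → Green w z s v
  green-Lap {w} z≥S≡0 w≡Lap zero d t+0≡N = green-leaf w z≥S≡0 d t+0≡N
  green-Lap {w} {z} z≥S≡0 w≡Lap (suc s) {t} {v} d t+s+1≡N
    rewrite green-suc {w} {z} {s} {v} (λ r r<a → green-Lap z≥S≡0 w≡Lap s (Depth-child d r<a) (child-height t+s+1≡N))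
          | w≡Lap v (Depth-< d (<-height t+s+1≡N))
    = noDefect _ (Q (suc s)) (Lap z v)
    where
    noDefect : ∀ x y ℓ → x + y * (ℓ - ℓ) ≡ x
    noDefect = solve-∀

-- The invariant factors

module Invariants (b n′ : ℕ) where

  open CollapsedTree (suc b) n′ public

  c : ℕ
  c = suc b

  R : ℕ
  R = q a n′ ℕ.* c

  -- Component 0 belongs to the root; component suc k compares child k % c of k / c with its last child c.
  Φ : ℕ → (ℕ → ℤ) → ℤ
  Φ zero    u = W u N 0
  Φ (suc k) u = gap u (N ∸ suc (depth (k / c))) (k / c) (k % c)

  modulus : ℕ → ℕ
  modulus zero    = q a (suc N)
  modulus (suc k) = q a (N ∸ depth (k / c))

  moduliHeap : List ℕ
  moduliHeap = applyUpTo modulus (suc R)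

  c<a : c < a
  c<a = ℕₚ.n<1+n c

  component-parent : ∀ {k} → k < R → suc (depth (k / c)) < N
  component-parent k<R = s≤s (<-Depth (Depth-depth _) (ℕD.m<n*o⇒m/o<n k<R))

  modulus-suc : ∀ {t} → suc t < N → q a (N ∸ t) ≡ q a (suc (N ∸ suc t))
  modulus-suc t+1<N = cong (q a) (ℕₚ.+-∸-assoc 1 (ℕₚ.<⇒≤ t+1<N))

  Φ-slot : ∀ {t p i} u → Depth t p → i < c → Φ (suc (p ℕ.* c ℕ.+ i)) u ≡ gap u (N ∸ suc t) p i
  Φ-slot {t} {p} {i} u d i<c rewrite [m*n+r]/n≡m p c i i<c | [m*n+r]%n≡r p c i i<c | depth-≡ d = refl

  modulus-slot : ∀ {t p i} → Depth t p → i < c → modulus (suc (p ℕ.* c ℕ.+ i)) ≡ q a (N ∸ t)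
  modulus-slot {t} {p} {i} d i<c rewrite [m*n+r]/n≡m p c i i<c | depth-≡ d = refl

  slot<R : ∀ {t p i} → Depth t p → suc t < N → i < c → p ℕ.* c ℕ.+ i < R
  slot<R {t} {p} {i} d (s≤s t<n′) i<c = begin-strict
    p ℕ.* c ℕ.+ i   <⟨ ℕₚ.+-monoʳ-< (p ℕ.* c) i<c ⟩
    p ℕ.* c ℕ.+ c   ≡⟨ ℕₚ.+-comm (p ℕ.* c) c ⟩
    suc p ℕ.* c     ≤⟨ ℕₚ.*-monoˡ-≤ c (Depth-< d t<n′) ⟩
    q a n′ ℕ.* c    ∎
    where open ℕₚ.≤-Reasoning

  modulus∣Φ-Lap : ∀ {w z} → VanishesFrom S z → (∀ v → v < S → w v ≡ Lap z v) →
    ∀ k → k < suc R → + modulus k ∣ Φ k w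
  modulus∣Φ-Lap {w} {z} z≥S≡0 w≡Lap zero _ =
    subst (Q (suc N) ∣_) (sym (green-Lap z≥S≡0 w≡Lap N Depth-root refl))
      (∣m∣n⇒∣m-n (∣n⇒∣m*n (Q N) (divides 0ℤ refl)) (∣m⇒∣m*n (z 0) ∣-refl))
  modulus∣Φ-Lap {w} {z} z≥S≡0 w≡Lap (suc k) (s≤s k<R) =
    subst (λ m → + m ∣ Φ (suc k) w) (sym (modulus-suc t+1<N))
      (subst (Q (suc s) ∣_) (sym (gap-green {w} {z} {s} {p} (greenChild i<a) (greenChild c<a) i<a))
        (∣m⇒∣m*n (z (child p c) - z (child p (k % c))) ∣-refl))
    where
    p = k / c
    s = N ∸ suc (depth p)
    t+1<N = component-parent k<R
    i<a = ℕₚ.<-trans (ℕD.m%n<n k c) c<a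
    greenChild : ∀ {r} → r < a → Green w z s (child p r)
    greenChild r<a = green-Lap z≥S≡0 w≡Lap s (Depth-child (Depth-depth p) r<a) (ℕₚ.m+[n∸m]≡n (ℕₚ.<⇒≤ t+1<N))

  module Solve (w : ℕ → ℤ) (root : Q (suc N) ∣ W w N 0)
    (siblings : ∀ {t p s} → Depth t p → suc t ℕ.+ s ≡ N → ∀ i → i < c → Q (suc s) ∣ gap w s p i)
    where

    step : ℕ → (ℕ → ℤ) → ℕ → ℤ
    step s u v = (Q s * par u v - W w s v) div Q (suc s)

    zAt : ℕ → ℕ → ℤ
    zAt zero    = step N (λ _ → 0ℤ)
    zAt (suc t) = step (N ∸ suc t) (zAt t)

    zFin : Fin S → ℤ
    zFin j = zAt (depth (toℕ j)) (toℕ j)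

    ẑ : ℕ → ℤ
    ẑ = zeroExtend zFin

    ẑ-Depth : ∀ {t v} → Depth t v → t < N → ẑ v ≡ zAt t v
    ẑ-Depth {t} {v} d t<N = trans (zeroExtend-< zFin (λ v → zAt (depth v) v) (λ _ → refl) v (Depth-< d t<N))
                                  (cong (λ t → zAt t v) (depth-≡ d))

    green-ẑ : ∀ t s {v} → Depth t v → t ℕ.+ s ≡ N → Green w ẑ s v
    green-ẑ t zero d t+0≡N = green-leaf w (zeroExtend-≥ zFin) d t+0≡N
    green-ẑ zero (suc s) {v} d refl with refl ← Depth-zero d =
      exact⇒green {w} {ẑ} {N} {0} (trans (cong (Q (suc N) *_) (ẑ-Depth d (s≤s z≤n))) (*-div root′))
      where
      root′ : Q (suc N) ∣ Q N * 0ℤ - W w N 0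
      root′ = ∣m∣n⇒∣m-n (∣n⇒∣m*n (Q N) (divides 0ℤ refl)) root
    green-ẑ (suc t) (suc s) {suc v} d t+s+2≡N =
      exact⇒green {w} {ẑ} {suc s} {suc v} (trans (cong (Q (suc (suc s)) *_) ẑv≡step) (*-div divisible))
      where
      p = v / a
      dp : Depth t p
      dp = Depth-parent d
      t+s+2≡N′ : t ℕ.+ suc (suc s) ≡ N
      t+s+2≡N′ = trans (ℕₚ.+-suc t (suc s)) t+s+2≡N
      ẑv≡step : ẑ (suc v) ≡ step (suc s) ẑ (suc v)
      ẑv≡step = trans (ẑ-Depth d (<-height {suc t} t+s+2≡N))
                  (cong₂ (λ s′ x → (Q s′ * x - W w s′ (suc v)) div Q (suc s′)) (∸-height {suc t} t+s+2≡N)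
                         (sym (ẑ-Depth dp (<-height {t} t+s+2≡N′))))
      divisible : Q (suc (suc s)) ∣ Q (suc s) * ẑ p - W w (suc s) (suc v)
      divisible = subst (λ x → Q (suc (suc s)) ∣ Q (suc s) * ẑ p - W w (suc s) x) (child-parent v)
                    (residues-divisible {w} {ẑ} {suc s} {p} (green-ẑ t (suc (suc s)) dp t+s+2≡N′) (siblings dp t+s+2≡N)
                                        (v % a) (ℕD.m%n<n v a))

    Lap-ẑ : ∀ v → v < S → w v ≡ Lap ẑ v
    Lap-ẑ v v<S = green⇒Lap {w} {ẑ} {s} {v}
      (λ r r<a → green-ẑ (suc t) s (Depth-child (Depth-depth v) r<a) t+1+s≡N)
      (green-ẑ t (suc s) (Depth-depth v) (trans (ℕₚ.+-suc t s) t+1+s≡N))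
      where
      t = depth v
      s = N ∸ suc t
      t+1+s≡N : suc t ℕ.+ s ≡ N
      t+1+s≡N = ℕₚ.m+[n∸m]≡n (<-Depth (Depth-depth v) v<S)

  divisible⇒image : ∀ (x : Fin S → ℤ) → (∀ k → k < suc R → + modulus k ∣ Φ k (zeroExtend x)) →
    Σ (Fin S → ℤ) λ z → ∀ j → x j ≡ (redLap S E · z) j
  divisible⇒image x divisible = zFin , λ j → begin
    x j                    ≡⟨ sym (zeroExtend-toℕ x j) ⟩
    w (toℕ j)              ≡⟨ Lap-ẑ (toℕ j) (Finₚ.toℕ<n j) ⟩
    Lap ẑ (toℕ j)          ≡⟨ sym (redLap-E-· zFin j) ⟩
    (redLap S E · zFin) j  ∎
    where
    open ≡-Reasoning
    w = zeroExtend x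
    root : Q (suc N) ∣ W w N 0
    root = divisible 0 (s≤s z≤n)
    -- Components exist only for parents whose children are not leaves; for leaves W vanishes.
    siblings : ∀ {t p s} → Depth t p → suc t ℕ.+ s ≡ N → ∀ i → i < c → Q (suc s) ∣ gap w s p i
    siblings {t} {p} {zero}  d _ i i<c = divides 0ℤ refl
    siblings {t} {p} {suc s} d t+s+2≡N i i<c =
      subst₂ (λ m x → + m ∣ x)
        (trans (modulus-slot d i<c) (cong (q a) (∸-height {t} (trans (ℕₚ.+-suc t (suc s)) t+s+2≡N))))
        (trans (Φ-slot w d i<c) (cong (λ s′ → gap w s′ p i) (∸-height {suc t} t+s+2≡N)))
        (divisible (suc (p ℕ.* c ℕ.+ i)) (s≤s (slot<R d (<-height {suc t} t+s+2≡N) i<c)))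
    open Solve w root siblings

  module Preimage (τ : ℕ → ℤ) where

    -- The last child c of p carries no component.
    τ′ : ℕ → ℕ → ℤ
    τ′ p r = if r <ᵇ c then τ (suc (p ℕ.* c ℕ.+ r)) else 0ℤ

    x : ℕ → ℤ
    x zero    = - (+ a * τ 0)
    x (suc v) = ∑[ r < a ] τ′ (v / a) r - + a * τ′ (v / a) (v % a)

    x-child : ∀ p {r} → r < a → x (child p r) ≡ ∑[ r′ < a ] τ′ p r′ - + a * τ′ p r
    x-child p {r} r<a rewrite [m*n+r]/n≡m p a r r<a | [m*n+r]%n≡r p a r r<a = refl

    xFin : Fin S → ℤ
    xFin j = x (toℕ j)

    x̂ : ℕ → ℤ
    x̂ = zeroExtend xFin

    x̂-< : ∀ {v} → v < S → x̂ v ≡ x v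
    x̂-< {v} = zeroExtend-< xFin x (λ _ → refl) v

    children-x̂ : ∀ v → ∑[ r < a ] x̂ (child v r) ≡ 0ℤ
    children-x̂ v with v ℕ.<? q a n′
    ... | yes v<qn′ = begin
      ∑[ r < a ] x̂ (child v r)
        ≡⟨ sumUpTo-cong a (λ r r<a → trans (x̂-< (child-< {n′} v<qn′ r<a)) (x-child v r<a)) ⟩
      ∑[ r < a ] (Στ - + a * τ′ v r)
        ≡⟨ sumUpTo-distrib-- a (λ _ → Στ) (λ r → + a * τ′ v r) ⟩
      ∑[ r < a ] Στ - ∑[ r < a ] (+ a * τ′ v r)
        ≡⟨ cong₂ _-_ (sumUpTo-const a Στ) (sym (*-distribˡ-sumUpTo a (+ a) (τ′ v))) ⟩
      + a * Στ - + a * Στ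
        ≡⟨ ℤₚ.+-inverseʳ (+ a * Στ) ⟩
      0ℤ
        ∎
      where
      open ≡-Reasoning
      Στ = ∑[ r < a ] τ′ v r
    ... | no  v≮qn′ =
      trans (sumUpTo-cong a (λ r _ → zeroExtend-≥ xFin (child v r) (child-≥ {n′} r (ℕₚ.≮⇒≥ v≮qn′))))
            (sumUpTo-zero a)

    W-x̂ : ∀ s v → W x̂ s v ≡ Q s * x̂ v
    W-x̂ zero    v = refl
    W-x̂ (suc s) v = begin
      Q (suc s) * x̂ v + ∑[ r < a ] W x̂ s (child v r)
        ≡⟨ cong (_+_ (Q (suc s) * x̂ v)) (trans (sumUpTo-cong a (λ r _ → W-x̂ s (child v r)))
                                              (sym (*-distribˡ-sumUpTo a (Q s) (λ r → x̂ (child v r))))) ⟩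
      Q (suc s) * x̂ v + Q s * ∑[ r < a ] x̂ (child v r)
        ≡⟨ cong (λ e → Q (suc s) * x̂ v + Q s * e) (children-x̂ v) ⟩
      Q (suc s) * x̂ v + Q s * 0ℤ
        ≡⟨ trans (cong (_+_ (Q (suc s) * x̂ v)) (ℤₚ.*-zeroʳ (Q s))) (ℤₚ.+-identityʳ _) ⟩
      Q (suc s) * x̂ v
        ∎
      where open ≡-Reasoning

    onto : ∀ k → k < suc R → + modulus k ∣ Φ k x̂ - τ k
    onto zero _ = subst (Q (suc N) ∣_) (sym root) (∣m⇒∣m*n (- τ 0) ∣-refl)
      where
      root : W x̂ N 0 - τ 0 ≡ Q (suc N) * - τ 0
      root = begin
        W x̂ N 0 - τ 0                   ≡⟨ cong (_- τ 0) (trans (W-x̂ N 0) (cong (Q N *_) (x̂-< (s≤s z≤n)))) ⟩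
        Q N * - (+ a * τ 0) - τ 0       ≡⟨ absorb (+ a) (Q N) (τ 0) ⟩
        (1ℤ + + a * Q N) * - τ 0        ≡⟨ cong (_* - τ 0) (sym (Q-suc N)) ⟩
        Q (suc N) * - τ 0               ∎
        where
        open ≡-Reasoning
        absorb : ∀ A q₀ y → q₀ * - (A * y) - y ≡ (1ℤ + A * q₀) * - y
        absorb = solve-∀
    onto (suc k) (s≤s k<R) =
      subst (λ m → + m ∣ Φ (suc k) x̂ - τ (suc k)) (sym (modulus-suc t+1<N))
        (subst (Q (suc s) ∣_) (sym component) (∣m⇒∣m*n (- τ (suc k)) ∣-refl))
      where
      p = k / c
      i = k % c
      s = N ∸ suc (depth p)
      t+1<N = component-parent k<R
      i<c : i < c
      i<c = ℕD.m%n<n k c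
      Στ = ∑[ r < a ] τ′ p r
      W-child : ∀ {r} → r < a → W x̂ s (child p r) ≡ Q s * (Στ - + a * τ′ p r)
      W-child r<a = trans (W-x̂ s (child p _))
        (cong (Q s *_) (trans (x̂-< (Depth-< (Depth-child (Depth-depth p) r<a) t+1<N)) (x-child p r<a)))
      τ′-i : τ′ p i ≡ τ (suc k)
      τ′-i rewrite <⇒<ᵇ≡true i<c = cong (λ k′ → τ (suc k′)) ([m/n]*n+m%n≡m k c)
      τ′-c : τ′ p c ≡ 0ℤ
      τ′-c rewrite ≥⇒<ᵇ≡false (ℕₚ.≤-refl {c}) = refl
      component : Φ (suc k) x̂ - τ (suc k) ≡ Q (suc s) * - τ (suc k)
      component = begin
        W x̂ s (child p i) - W x̂ s (child p c) - τ (suc k)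
          ≡⟨ cong₂ (λ x y → x - y - τ (suc k)) (W-child (ℕₚ.<-trans i<c c<a)) (W-child c<a) ⟩
        Q s * (Στ - + a * τ′ p i) - Q s * (Στ - + a * τ′ p c) - τ (suc k)
          ≡⟨ cong₂ (λ x y → Q s * (Στ - + a * x) - Q s * (Στ - + a * y) - τ (suc k)) τ′-i τ′-c ⟩
        Q s * (Στ - + a * τ (suc k)) - Q s * (Στ - + a * 0ℤ) - τ (suc k)
          ≡⟨ absorb (+ a) (Q s) Στ (τ (suc k)) ⟩
        (1ℤ + + a * Q s) * - τ (suc k)
          ≡⟨ cong (_* - τ (suc k)) (sym (Q-suc s)) ⟩
        Q (suc s) * - τ (suc k)
          ∎
        where
        open ≡-Reasoning
        absorb : ∀ A q₀ σ y → q₀ * (σ - A * y) - q₀ * (σ - A * 0ℤ) - y ≡ (1ℤ + A * q₀) * - y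
        absorb = solve-∀

  Φ-cong : ∀ k {u u′} → (∀ v → u v ≡ u′ v) → Φ k u ≡ Φ k u′
  Φ-cong zero    eq = W-cong eq N 0
  Φ-cong (suc k) eq = cong₂ _-_ (W-cong eq s (child p (k % c))) (W-cong eq s (child p c))
    where
    p = k / c
    s = N ∸ suc (depth p)

  Φ-+ : ∀ k u u′ → Φ k (λ v → u v + u′ v) ≡ Φ k u + Φ k u′
  Φ-+ zero    u u′ = W-+ u u′ N 0
  Φ-+ (suc k) u u′ =
    trans (cong₂ _-_ (W-+ u u′ s (child p i)) (W-+ u u′ s (child p c)))
          (sym (minus-interchange (W u s (child p i)) (W u s (child p c)) (W u′ s (child p i)) (W u′ s (child p c))))
    where
    p = k / c
    i = k % c
    s = N ∸ suc (depth p)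

  lookup-moduliHeap : ∀ ι → lookup moduliHeap ι ≡ modulus (toℕ ι)
  lookup-moduliHeap = Listₚ.lookup-applyUpTo modulus (suc R)

  toℕ<1+R : ∀ (ι : Fin (length moduliHeap)) → toℕ ι < suc R
  toℕ<1+R ι = subst (toℕ ι <_) (Listₚ.length-applyUpTo modulus (suc R)) (Finₚ.toℕ<n ι)

  everyComponent : ∀ {P : ℕ → Set} → (∀ (ι : Fin (length moduliHeap)) → P (toℕ ι)) → ∀ k → k < suc R → P k
  everyComponent {P} h k k<1+R = subst P (Finₚ.toℕ-fromℕ< k<length) (h (fromℕ< k<length))
    where
    k<length = subst (k <_) (sym (Listₚ.length-applyUpTo modulus (suc R))) k<1+R

  F : ℤ^ S → ℤ^ (length moduliHeap)
  F x ι = Φ (toℕ ι) (zeroExtend x)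

  F-image⊆kernel : ∀ z ι → + lookup moduliHeap ι ∣ F (redLap S E · z) ι
  F-image⊆kernel z ι =
    subst (λ m → + m ∣ F (redLap S E · z) ι) (sym (lookup-moduliHeap ι))
      (modulus∣Φ-Lap (zeroExtend-≥ z) (zeroExtend-< (redLap S E · z) (Lap (zeroExtend z)) (redLap-E-· z))
                     (toℕ ι) (toℕ<1+R ι))

  F-kernel⊆image : ∀ x → (∀ ι → + lookup moduliHeap ι ∣ F x ι) → Σ (ℤ^ S) λ z → ∀ j → x j ≡ (redLap S E · z) j
  F-kernel⊆image x divisible = divisible⇒image x (everyComponent {λ k → + modulus k ∣ Φ k (zeroExtend x)}
    (λ ι → subst (λ m → + m ∣ F x ι) (lookup-moduliHeap ι) (divisible ι)))

  F-onto : ∀ t → Σ (ℤ^ S) λ x → ∀ ι → + lookup moduliHeap ι ∣ F x ι - t ι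
  F-onto t = xFin , λ ι →
    subst₂ (λ m y → + m ∣ F xFin ι - y) (sym (lookup-moduliHeap ι)) (zeroExtend-toℕ t ι) (onto (toℕ ι) (toℕ<1+R ι))
    where open Preimage (zeroExtend t)

  linearSandpileIso : LinearSandpileIso S E moduliHeap
  linearSandpileIso = record
    { F            = F
    ; F-cong       = λ eq ι → Φ-cong (toℕ ι) (zeroExtend-cong eq)
    ; F-+          = λ x y ι → trans (Φ-cong (toℕ ι) (zeroExtend-+ x y)) (Φ-+ (toℕ ι) (zeroExtend x) (zeroExtend y))
    ; image⊆kernel = F-image⊆kernel
    ; kernel⊆image = F-kernel⊆image
    ; onto         = F-onto
    }

  sandpileIso-heap : SandpileIso S E moduliHeap
  sandpileIso-heap = LinearSandpileIso.sandpileIso linearSandpileIso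

  moduliAtDepth : ℕ → List ℕ
  moduliAtDepth t = replicate (a ^ t ℕ.* c) (q a (N ∸ t))

  moduliHeap-levels : ∀ K → applyUpTo (λ k → modulus (suc k)) (q a K ℕ.* c) ≡ concat (applyUpTo moduliAtDepth K)
  moduliHeap-levels zero    = refl
  moduliHeap-levels (suc K) = begin
    applyUpTo m (q a (suc K) ℕ.* c)
      ≡⟨ cong (applyUpTo m) (trans (cong (ℕ._* c) (q-suc K)) (ℕₚ.*-distribʳ-+ c (q a K) (a ^ K))) ⟩
    applyUpTo m (q a K ℕ.* c ℕ.+ a ^ K ℕ.* c)
      ≡⟨ applyUpTo-+ m (q a K ℕ.* c) (a ^ K ℕ.* c) ⟩
    applyUpTo m (q a K ℕ.* c) ++ applyUpTo (λ j → m (q a K ℕ.* c ℕ.+ j)) (a ^ K ℕ.* c)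
      ≡⟨ cong₂ _++_ (moduliHeap-levels K) (applyUpTo-replicate _ (a ^ K ℕ.* c) onLevel) ⟩
    concat (applyUpTo moduliAtDepth K) ++ moduliAtDepth K
      ≡⟨ sym (concat-applyUpTo-suc moduliAtDepth K) ⟩
    concat (applyUpTo moduliAtDepth (suc K))
      ∎
    where
    open ≡-Reasoning
    m : ℕ → ℕ
    m k = modulus (suc k)
    onLevel : ∀ j → j < a ^ K ℕ.* c → m (q a K ℕ.* c ℕ.+ j) ≡ q a (N ∸ K)
    onLevel j j<aᴷc = cong (λ t → q a (N ∸ t)) (trans (cong depth parent≡) (depth-≡ d))
      where
      parent≡ : (q a K ℕ.* c ℕ.+ j) / c ≡ q a K ℕ.+ j / c
      parent≡ = trans (ℕD.+-distrib-/-∣ˡ j (ℕDiv.n∣m*n (q a K))) (cong (ℕ._+ j / c) (ℕD.m*n/n≡m (q a K) c))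
      d : Depth K (q a K ℕ.+ j / c)
      d = ℕₚ.m≤m+n (q a K) (j / c) ,
          subst (q a K ℕ.+ j / c <_) (sym (q-suc K)) (ℕₚ.+-monoʳ-< (q a K) (ℕD.m<n*o⇒m/o<n j<aᴷc))

  moduliHeap↭moduli : moduliHeap ↭ moduli a (suc N)
  moduliHeap↭moduli = ↭.prep refl (begin
    applyUpTo (λ k → modulus (suc k)) R
      ≡⟨ moduliHeap-levels n′ ⟩
    concat (applyUpTo moduliAtDepth n′)
      ↭⟨ concat-applyUpTo-reverse moduliAtDepth n′ ⟩
    concat (applyUpTo (λ j → moduliAtDepth (n′ ∸ suc j)) n′)
      ≡⟨ cong concat (trans (applyUpTo-cong n′ moduliAtDepth≡block) (sym (Listₚ.map-upTo block n′))) ⟩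
    concat (map block (upTo n′))
      ∎)
    where
    open ↭.PermutationReasoning
    block : ℕ → List ℕ
    block j = replicate (a ^ (N ∸ (j ℕ.+ 2)) ℕ.* (a ∸ 1)) (q a (j ℕ.+ 2))
    moduliAtDepth≡block : ∀ j → j < n′ → moduliAtDepth (n′ ∸ suc j) ≡ block j
    moduliAtDepth≡block j j<n′ rewrite ℕₚ.+-comm j 2 =
      cong (replicate (a ^ (n′ ∸ suc j) ℕ.* c)) (cong (q a) (ℕₚ.m∸[m∸n]≡n {N} {suc (suc j)} (s≤s j<n′)))

theorem1p2 : (d n : ℕ) → 3 ≤ d → 2 ≤ n →
    SandpileIso (q (d ∸ 1) (n ∸ 1)) (barTEdges (d ∸ 1) n) (moduli (d ∸ 1) n)
theorem1p2 (suc (suc (suc b))) (suc (suc n′)) (s≤s (s≤s (s≤s _))) (s≤s (s≤s _)) =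
  SandpileIso-↭ {S} {E} moduliHeap↭moduli sandpileIso-heap
  where open Invariants b n′
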